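{- For every integer $n\geq 13$ with $n\equiv 1\pmod 4$, there exists a Heffter array $H(n;5)$.
   Context: A Heffter array $H(n;k)$ is an $n\times n$ array, some of whose cells are filled with integers, such that: each row and each column contains exactly $k$ filled cells; every row sum and column sum is congruent to $0$ modulo $2nk+1$; and for each integer $1\leq x\leq nk$, either $x$ or $-x$ appears in the array. -}

module Defs where

open import Data.Nat as ℕ using (ℕ; suc; _+_; _*_; _≤_)
open import Data.Integer as ℤ using (ℤ; +_; -_)
open import Data.Integer.Divisibility using (_∣_)
open import Data.Fin using (Fin)
open import Data.Maybe using (Maybe; just; nothing)
open import Data.Product using (_×_; ∃-syntax)
open import Data.Sum using (_⊎_)
open import Relation.Binary.PropositionalEquality using (_≡_)

-- A partially filled n × n array of integers: nothing = empty cell.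
PArray : ℕ → Set
PArray n = Fin n → Fin n → Maybe ℤ

filledCount : ∀ {m} → (Fin m → Maybe ℤ) → ℕ
filledCount {ℕ.zero} f = 0
filledCount {suc m} f with f Data.Fin.zero
... | just _  = suc (filledCount (λ i → f (Data.Fin.suc i)))
... | nothing = filledCount (λ i → f (Data.Fin.suc i))

lineSum : ∀ {m} → (Fin m → Maybe ℤ) → ℤ
lineSum {ℕ.zero} f = + 0
lineSum {suc m} f with f Data.Fin.zero
... | just a  = a ℤ.+ lineSum (λ i → f (Data.Fin.suc i))
... | nothing = lineSum (λ i → f (Data.Fin.suc i))

row : ∀ {n} → PArray n → Fin n → Fin n → Maybe ℤ
row A i = λ j → A i j

col : ∀ {n} → PArray n → Fin n → Fin n → Maybe ℤ
col A j = λ i → A i j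

record IsHeffter (n k : ℕ) (A : PArray n) : Set where
  field
    rowCount : ∀ i → filledCount (row A i) ≡ k
    colCount : ∀ j → filledCount (col A j) ≡ k
    rowSum   : ∀ i → + (2 * n * k + 1) ∣ lineSum (row A i)
    colSum   : ∀ j → + (2 * n * k + 1) ∣ lineSum (col A j)
    covers   : ∀ x → 1 ≤ x → x ≤ n * k →
               ∃[ i ] ∃[ j ] (A i j ≡ just (+ x) ⊎ A i j ≡ just (- (+ x)))

HeffterArray : ℕ → ℕ → Set
HeffterArray n k = ∃[ A ] IsHeffter n k A

module Submission where

open import Defs
open import Data.Nat using (ℕ; _≤_; _%_)
open import Relation.Binary.PropositionalEquality using (_≡_)

open import Data.Nat using (zero; suc; _<_; _≤ᵇ_; z≤n; s≤s; _<?_; _/_)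
import Data.Nat as ℕ
import Data.Nat.Properties as ℕₚ
import Data.Nat.DivMod as DM
open import Data.Nat.Divisibility using (∣-refl)
open import Data.Nat.Tactic.RingSolver using (solve)
import Data.Nat.Tactic.RingSolver as ℕ-Solver
open import Data.Integer as ℤ using (ℤ; +_; -_)
import Data.Integer.Properties as ℤₚ
open import Data.Integer.Divisibility using (_∣_)
open import Data.Integer.Tactic.RingSolver using (solve-∀)
open import Data.Bool using (true; false; if_then_else_; T)
open import Data.Bool.Properties using (T-≡)
open import Data.Empty using (⊥-elim)
open import Data.List using (List; []; _∷_)
open import Data.List.Relation.Unary.All as All using (All)
open import Data.List.Relation.Unary.Any using (here; there)
open import Data.List.Membership.Propositional using (_∈_)
open import Data.List.Relation.Unary.Unique.Propositional using (Unique)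
import Data.List.Relation.Unary.AllPairs as AllPairs
import Data.List.Relation.Unary.Linked as Linked
open import Data.List.Relation.Unary.Linked.Properties using (Linked⇒AllPairs)
open import Data.Product using (_×_; _,_; ∃-syntax)
open import Data.Sum using (_⊎_; inj₁; inj₂)
open import Function using (_∘_; _⇔_; mk⇔; Equivalence)
open import Relation.Nullary using (yes; no)
open import Relation.Binary.PropositionalEquality using (refl; sym; trans; cong; subst; subst₂)

-- With n = 4m + 1, row x of the array has entries in the columns x, x + m, x + m + 1, x + 3m and
-- x + 3m + 1 (mod n), and the entry on each of these five cyclic diagonals depends on the row
-- alone. Each diagonal's entry is an affine function of x corrected by multiples of n times
-- Iverson brackets ⟦ t ≤ x ⟧. In a row sum the brackets cancel identically, leaving
-- 40m + 11 = 2·5n + 1. Diagonal d meets column j in row (j − d) mod n, and the brackets of that row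
-- are again brackets in j; after this substitution they cancel in every column sum too. Finally, on
-- every row interval on which its brackets are constant a diagonal runs through consecutive values
-- (the main diagonal through values 4 apart), and these runs tile {1, …, 5n} up to sign.

module Circulant where
  open import Data.Nat using (_+_; _*_; _∸_; _≡ᵇ_; _<ᵇ_)
  open import Data.Nat.Properties
  open import Algebra.Bundles using (CommutativeMonoid)
  open import Data.Bool using (Bool)
  open import Data.Bool.Properties using (⇔→≡)
  open import Data.Empty using (⊥)
  open import Data.Fin using (Fin; toℕ; fromℕ<) renaming (zero to fzero; suc to fsuc)
  open import Data.Fin.Properties using (toℕ<n; toℕ-fromℕ<)
  open import Data.Maybe using (Maybe; just; nothing; fromMaybe)
  open import Data.List using (map; length)
  open import Data.List.Relation.Unary.All using ([]; _∷_)
  open import Data.List.Relation.Unary.Unique.Propositional using ([]; _∷_)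
  open import Data.List.Membership.Propositional.Properties using (∈-map⁺)
  open import Data.Product using (proj₁; proj₂)
  import Data.Sum
  open import Relation.Binary.PropositionalEquality as ≡ using (_≢_; ≢-sym; cong₂)

  addMod : ℕ → ℕ → ℕ → ℕ
  addMod n a k = if a + k <ᵇ n then a + k else a + k ∸ n

  subMod : ℕ → ℕ → ℕ → ℕ
  subMod n b a = if a ≤ᵇ b then b ∸ a else n + b ∸ a

  data CyclicShift (n a k b : ℕ) : Set where
    direct  : a + k ≡ b     → CyclicShift n a k b
    wrapped : a + k ≡ b + n → CyclicShift n a k b

  addMod-shift : ∀ {n a k} → a < n → k < n → addMod n a k < n × CyclicShift n a k (addMod n a k)
  addMod-shift {n} {a} {k} a<n k<n with a + k <ᵇ n in eq
  ... | true  = <ᵇ⇒< (a + k) n (subst T (sym eq) _) , direct refl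
  ... | false = +-cancelʳ-< n (a + k ∸ n) n (subst (_< n + n) (sym (m∸n+n≡m n≤a+k)) (+-mono-< a<n k<n))
              , wrapped (sym (m∸n+n≡m n≤a+k))
    where
    n≤a+k : n ≤ a + k
    n≤a+k = ≮⇒≥ (λ a+k<n → subst T eq (<⇒<ᵇ a+k<n))

  subMod-shift : ∀ {n a b} → a < n → b < n → subMod n b a < n × CyclicShift n a (subMod n b a) b
  subMod-shift {n} {a} {b} a<n b<n with a ≤ᵇ b in eq
  ... | true  = ≤-<-trans (m∸n≤m b a) b<n , direct (m+[n∸m]≡n (≤ᵇ⇒≤ a b (subst T (sym eq) _)))
  ... | false = +-cancelˡ-< a (n + b ∸ a) n (subst (_< a + n) (sym (m+[n∸m]≡n a≤n+b)) (subst (n + b <_) (+-comm n a) (+-monoʳ-< n b<a)))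
              , wrapped (trans (m+[n∸m]≡n a≤n+b) (+-comm n b))
    where
    b<a : b < a
    b<a = ≰⇒> (λ a≤b → subst T eq (≤⇒≤ᵇ a≤b))
    a≤n+b : a ≤ n + b
    a≤n+b = ≤-trans (<⇒≤ a<n) (m≤m+n n b)

  shift-comm : ∀ {n a k b} → CyclicShift n a k b → CyclicShift n k a b
  shift-comm {a = a} {k} (direct p)  = direct (trans (+-comm k a) p)
  shift-comm {a = a} {k} (wrapped p) = wrapped (trans (+-comm k a) p)

  shift-functional : ∀ {n a k b b′} → CyclicShift n a k b → CyclicShift n a k b′ → b < n → b′ < n → b ≡ b′
  shift-functional                (direct p)  (direct q)  _   _    = trans (sym p) q
  shift-functional {n} {b′ = b′}  (direct p)  (wrapped q) b<n _    = ⊥-elim (m+n≮n b′ n (subst (_< n) (trans (sym p) q) b<n))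
  shift-functional {n} {b = b}    (wrapped p) (direct q)  _   b′<n = ⊥-elim (m+n≮n b n (subst (_< n) (trans (sym q) p) b′<n))
  shift-functional {n}            (wrapped p) (wrapped q) _   _    = +-cancelʳ-≡ n _ _ (trans (sym p) q)

  private
    no-wrap : ∀ {n a k k′ b} → a + k ≡ b → a + k′ ≡ b + n → k′ < n → ⊥
    no-wrap {n} {a} {k} {k′} p q k′<n = m+n≮n k n (subst (_< n) k′≡k+n k′<n)
      where
      k′≡k+n : k′ ≡ k + n
      k′≡k+n = +-cancelˡ-≡ a k′ (k + n) (trans q (trans (cong (_+ n) (sym p)) (+-assoc a k n)))

  shift-injectiveʳ : ∀ {n a k k′ b} → CyclicShift n a k b → CyclicShift n a k′ b → k < n → k′ < n → k ≡ k′
  shift-injectiveʳ {a = a} (direct p)  (direct q)  _   _    = +-cancelˡ-≡ a _ _ (trans p (sym q))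
  shift-injectiveʳ         (direct p)  (wrapped q) _   k′<n = ⊥-elim (no-wrap p q k′<n)
  shift-injectiveʳ         (wrapped p) (direct q)  k<n _    = ⊥-elim (no-wrap q p k<n)
  shift-injectiveʳ {a = a} (wrapped p) (wrapped q) _   _    = +-cancelˡ-≡ a _ _ (trans p (sym q))

  shift-injectiveˡ : ∀ {n a a′ k b} → CyclicShift n a k b → CyclicShift n a′ k b → a < n → a′ < n → a ≡ a′
  shift-injectiveˡ p q = shift-injectiveʳ (shift-comm p) (shift-comm q)

  subMod≡⇔addMod≡ : ∀ {n a b d} → a < n → b < n → d < n → subMod n b a ≡ d ⇔ b ≡ addMod n a d
  subMod≡⇔addMod≡ {n} {a} {b} {d} a<n b<n d<n = mk⇔
    (λ { refl → shift-functional (proj₂ b−a) (proj₂ a+d) b<n (proj₁ a+d) })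
    (λ { refl → shift-injectiveʳ (proj₂ b−a) (proj₂ a+d) (proj₁ b−a) d<n })
    where
    b−a = subMod-shift a<n b<n
    a+d = addMod-shift a<n d<n

  subMod≡⇔subMod≡ : ∀ {n a b d} → a < n → b < n → d < n → subMod n b a ≡ d ⇔ a ≡ subMod n b d
  subMod≡⇔subMod≡ {n} {a} {b} {d} a<n b<n d<n = mk⇔
    (λ { refl → shift-injectiveˡ (proj₂ b−a) (shift-comm (proj₂ b−d)) a<n (proj₁ b−d) })
    (λ { refl → shift-injectiveʳ (proj₂ b−a) (shift-comm (proj₂ b−d)) (proj₁ b−a) d<n })
    where
    b−a = subMod-shift a<n b<n
    b−d = subMod-shift d<n b<n

  ≢⇒≡ᵇ-false : ∀ {x y} → x ≢ y → (x ≡ᵇ y) ≡ false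
  ≢⇒≡ᵇ-false {x} {y} x≢y with x ≡ᵇ y in eq
  ... | true  = ⊥-elim (x≢y (≡ᵇ⇒≡ x y (subst T (sym eq) _)))
  ... | false = refl

  ≡ᵇ-cong : ∀ {x y z w} → x ≡ y ⇔ z ≡ w → (x ≡ᵇ y) ≡ (z ≡ᵇ w)
  ≡ᵇ-cong {x} {y} {z} {w} x≡y⇔z≡w = ⇔→≡ {z = true} (mk⇔
    (λ e → Equivalence.to T-≡ (≡⇒≡ᵇ z w (Equivalence.to x≡y⇔z≡w (≡ᵇ⇒≡ x y (Equivalence.from T-≡ e)))))
    (λ e → Equivalence.to T-≡ (≡⇒≡ᵇ x y (Equivalence.from x≡y⇔z≡w (≡ᵇ⇒≡ z w (Equivalence.from T-≡ e))))))

  -- A diagonal (d , v) fills the cell in row x and column (x + d) mod n with v x.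
  Diagonal : Set
  Diagonal = ℕ × (ℕ → ℤ)

  offsets : List Diagonal → List ℕ
  offsets = map proj₁

  entry : List Diagonal → ℕ → ℕ → Maybe ℤ
  entry []             x k = nothing
  entry ((d , v) ∷ ds) x k = if k ≡ᵇ d then just (v x) else entry ds x k

  circulant : (n : ℕ) → List Diagonal → PArray n
  circulant n ds i j = entry ds (toℕ i) (subMod n (toℕ j) (toℕ i))

  module LineSums {c ℓ} (M : CommutativeMonoid c ℓ) where
    open CommutativeMonoid M renaming (Carrier to C; refl to ≈-refl; sym to ≈-sym; trans to ≈-trans)
    open import Algebra.Properties.CommutativeMonoid.Sum M public using (sum)
    open import Algebra.Properties.CommutativeMonoid.Sum M using (∑-distrib-+; sum-cong-≋; sum-cong-≗; sum-replicate-zero)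
    open import Relation.Binary.Reasoning.Setoid setoid

    when : Bool → C → C
    when b x = if b then x else ε

    ∑ₗ : List Diagonal → (Diagonal → C) → C
    ∑ₗ []       g = ε
    ∑ₗ (e ∷ es) g = g e ∙ ∑ₗ es g

    sum-indicator : ∀ {k} c (h : ℕ → C) → c < k → sum {k} (λ i → when (toℕ i ≡ᵇ c) (h (toℕ i))) ≈ h c
    sum-indicator {suc k} zero    h _         = ≈-trans (∙-congˡ (sum-replicate-zero k)) (identityʳ (h 0))
    sum-indicator {suc k} (suc c) h (s≤s c<k) = ≈-trans (identityˡ _) (sum-indicator c (λ x → h (suc x)) c<k)

    module _ (f : Maybe ℤ → C) (f-nothing : f nothing ≈ ε) where

      ∑ₗ-vanishes : ∀ {k} ds x → All (k ≢_) (offsets ds) → ∑ₗ ds (λ (d , v) → when (k ≡ᵇ d) (f (just (v x)))) ≈ ε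
      ∑ₗ-vanishes []             x []           = ≈-refl
      ∑ₗ-vanishes ((d , v) ∷ ds) x (k≢d ∷ k∉ds) rewrite ≢⇒≡ᵇ-false k≢d = ≈-trans (identityˡ _) (∑ₗ-vanishes ds x k∉ds)

      entry-as-∑ₗ : ∀ ds x k → Unique (offsets ds) → f (entry ds x k) ≈ ∑ₗ ds (λ (d , v) → when (k ≡ᵇ d) (f (just (v x))))
      entry-as-∑ₗ []             x k []               = f-nothing
      entry-as-∑ₗ ((d , v) ∷ ds) x k (d∉ds ∷ ds-uniq) with k ≡ᵇ d in eq
      ... | true rewrite ≡ᵇ⇒≡ k d (subst T (sym eq) _) = ≈-sym (≈-trans (∙-congˡ (∑ₗ-vanishes ds x d∉ds)) (identityʳ _))
      ... | false = ≈-trans (entry-as-∑ₗ ds x k ds-uniq) (≈-sym (identityˡ _))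

      module _ {n} (ds : List Diagonal) (ds-uniq : Unique (offsets ds)) (ds<n : All (_< n) (offsets ds)) where

        -- meets: diagonal d crosses the line, whose cells are indexed by j, exactly at j = pos d.
        private
          sum-∑ₗ-indicator : (p : Fin n → ℕ) (pos : ℕ → ℕ) (H : Diagonal → ℕ → C) →
                             (∀ {d} → d < n → pos d < n × (∀ j → (p j ≡ᵇ d) ≡ (toℕ j ≡ᵇ pos d))) →
                             ∀ es → All (_< n) (offsets es) →
                             sum {n} (λ j → ∑ₗ es (λ e → when (p j ≡ᵇ proj₁ e) (H e (toℕ j))))
                               ≈ ∑ₗ es (λ e → H e (pos (proj₁ e)))
          sum-∑ₗ-indicator p pos H meets []               []           = sum-replicate-zero n
          sum-∑ₗ-indicator p pos H meets (e@(d , v) ∷ es) (d<n ∷ es<n) = begin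
            sum {n} (λ j → when (p j ≡ᵇ d) (H e (toℕ j)) ∙ rest j)
              ≈⟨ ∑-distrib-+ {n} _ rest ⟩
            sum {n} (λ j → when (p j ≡ᵇ d) (H e (toℕ j))) ∙ sum {n} rest
              ≈⟨ ∙-cong (reflexive (sum-cong-≗ {n} λ j → cong (λ b → when b (H e (toℕ j))) (proj₂ (meets d<n) j)))
                        (sum-∑ₗ-indicator p pos H meets es es<n) ⟩
            sum {n} (λ j → when (toℕ j ≡ᵇ pos d) (H e (toℕ j))) ∙ ∑ₗ es (λ e → H e (pos (proj₁ e)))
              ≈⟨ ∙-congʳ (sum-indicator (pos d) (H e) (proj₁ (meets d<n))) ⟩
            H e (pos d) ∙ ∑ₗ es (λ e → H e (pos (proj₁ e)))
              ∎
            where rest = λ j → ∑ₗ es (λ e → when (p j ≡ᵇ proj₁ e) (H e (toℕ j)))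

        row-sum : ∀ i → sum {n} (λ j → f (circulant n ds i j)) ≈ ∑ₗ ds (λ (d , v) → f (just (v (toℕ i))))
        row-sum i = ≈-trans
          (sum-cong-≋ {n} λ j → entry-as-∑ₗ ds (toℕ i) _ ds-uniq)
          (sum-∑ₗ-indicator (λ j → subMod n (toℕ j) (toℕ i)) (addMod n (toℕ i)) (λ (d , v) _ → f (just (v (toℕ i))))
            (λ d<n → proj₁ (addMod-shift (toℕ<n i) d<n) , λ j → ≡ᵇ-cong (subMod≡⇔addMod≡ (toℕ<n i) (toℕ<n j) d<n))
            ds ds<n)

        column-sum : ∀ j → sum {n} (λ i → f (circulant n ds i j)) ≈ ∑ₗ ds (λ (d , v) → f (just (v (subMod n (toℕ j) d))))
        column-sum j = ≈-trans
          (sum-cong-≋ {n} λ i → entry-as-∑ₗ ds (toℕ i) _ ds-uniq)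
          (sum-∑ₗ-indicator (λ i → subMod n (toℕ j) (toℕ i)) (subMod n (toℕ j)) (λ (d , v) x → f (just (v x)))
            (λ d<n → proj₁ (subMod-shift d<n (toℕ<n j)) , λ i → ≡ᵇ-cong (subMod≡⇔subMod≡ (toℕ<n i) (toℕ<n j) d<n))
            ds ds<n)

  module ℕ-lines = LineSums ℕₚ.+-0-commutativeMonoid
  module ℤ-lines = LineSums ℤₚ.+-0-commutativeMonoid

  χ : Maybe ℤ → ℕ
  χ (just _) = 1
  χ nothing  = 0

  filledCount≡sum : ∀ {k} (g : Fin k → Maybe ℤ) → filledCount g ≡ ℕ-lines.sum (χ ∘ g)
  filledCount≡sum {zero}  g = refl
  filledCount≡sum {suc k} g with g fzero
  ... | just _  = cong suc (filledCount≡sum (g ∘ fsuc))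
  ... | nothing = filledCount≡sum (g ∘ fsuc)

  lineSum≡sum : ∀ {k} (g : Fin k → Maybe ℤ) → lineSum g ≡ ℤ-lines.sum (fromMaybe (+ 0) ∘ g)
  lineSum≡sum {zero}  g = refl
  lineSum≡sum {suc k} g with g fzero
  ... | just a  = cong (λ s → a ℤ.+ s) (lineSum≡sum (g ∘ fsuc))
  ... | nothing = trans (lineSum≡sum (g ∘ fsuc)) (sym (ℤₚ.+-identityˡ _))

  ∑ₗ-ones : ∀ ds → ℕ-lines.∑ₗ ds (λ _ → 1) ≡ length ds
  ∑ₗ-ones []       = refl
  ∑ₗ-ones (_ ∷ ds) = cong suc (∑ₗ-ones ds)

  entry-∈ : ∀ {d v} ds x → Unique (offsets ds) → (d , v) ∈ ds → entry ds x d ≡ just (v x)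
  entry-∈ {d} ((d , v) ∷ ds) x _ (here refl) rewrite Equivalence.to T-≡ (≡⇒≡ᵇ d d refl) = refl
  entry-∈ {d} ((d′ , v′) ∷ ds) x (d′∉ds ∷ ds-uniq) (there dv∈ds)
    rewrite ≢⇒≡ᵇ-false (≢-sym (All.lookup d′∉ds (∈-map⁺ proj₁ dv∈ds))) = entry-∈ ds x ds-uniq dv∈ds

  circulant-∈ : ∀ {n d v} ds → Unique (offsets ds) → (d , v) ∈ ds → d < n → ∀ {x} → x < n →
                ∃[ i ] ∃[ j ] circulant n ds i j ≡ just (v x)
  circulant-∈ {n} {d} {v} ds ds-uniq dv∈ds d<n {x} x<n = fromℕ< x<n , fromℕ< x+d<n , (begin
    entry ds (toℕ (fromℕ< x<n)) (subMod n (toℕ (fromℕ< x+d<n)) (toℕ (fromℕ< x<n)))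
      ≡⟨ cong₂ (λ x′ j′ → entry ds x′ (subMod n j′ x′)) (toℕ-fromℕ< x<n) (toℕ-fromℕ< x+d<n) ⟩
    entry ds x (subMod n (addMod n x d) x)
      ≡⟨ cong (entry ds x) (Equivalence.from (subMod≡⇔addMod≡ x<n x+d<n d<n) refl) ⟩
    entry ds x d
      ≡⟨ entry-∈ ds x ds-uniq dv∈ds ⟩
    just (v x) ∎)
    where
    open ≡.≡-Reasoning
    x+d<n = proj₁ (addMod-shift x<n d<n)

  Realises : ℕ → List Diagonal → ℕ → Set
  Realises n ds y = ∃[ d ] ∃[ v ] (d , v) ∈ ds × ∃[ x ] x < n × (v x ≡ + y ⊎ v x ≡ - + y)

  circulant-isHeffter : ∀ n ds → Unique (offsets ds) → All (_< n) (offsets ds) →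
    (∀ x → x < n → + (2 * n * length ds + 1) ∣ ℤ-lines.∑ₗ ds (λ (d , v) → v x)) →
    (∀ j → j < n → + (2 * n * length ds + 1) ∣ ℤ-lines.∑ₗ ds (λ (d , v) → v (subMod n j d))) →
    (∀ y → 1 ≤ y → y ≤ n * length ds → Realises n ds y) →
    IsHeffter n (length ds) (circulant n ds)
  circulant-isHeffter n ds ds-uniq ds<n rows columns realised = record
    { rowCount = λ i → trans (filledCount≡sum (row A i)) (trans (ℕ-lines.row-sum χ refl ds ds-uniq ds<n i) (∑ₗ-ones ds))
    ; colCount = λ j → trans (filledCount≡sum (col A j)) (trans (ℕ-lines.column-sum χ refl ds ds-uniq ds<n j) (∑ₗ-ones ds))
    ; rowSum   = λ i → subst (modulus ∣_) (sym (trans (lineSum≡sum (row A i)) (ℤ-lines.row-sum (fromMaybe (+ 0)) refl ds ds-uniq ds<n i)))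
                             (rows (toℕ i) (toℕ<n i))
    ; colSum   = λ j → subst (modulus ∣_) (sym (trans (lineSum≡sum (col A j)) (ℤ-lines.column-sum (fromMaybe (+ 0)) refl ds ds-uniq ds<n j)))
                             (columns (toℕ j) (toℕ<n j))
    ; covers   = λ y 1≤y y≤nk → located (realised y 1≤y y≤nk)
    }
    where
    A = circulant n ds
    modulus = + (2 * n * length ds + 1)
    located : ∀ {y} → Realises n ds y → ∃[ i ] ∃[ j ] (A i j ≡ just (+ y) ⊎ A i j ≡ just (- + y))
    located (d , v , dv∈ds , x , x<n , vx≡±y) with circulant-∈ ds ds-uniq dv∈ds (All.lookup ds<n (∈-map⁺ proj₁ dv∈ds)) x<n
    ... | i , j , Aij≡vx = i , j , Data.Sum.map (trans Aij≡vx ∘ cong just) (trans Aij≡vx ∘ cong just) vx≡±y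

  Covers : ℕ → List Diagonal → ℕ → ℕ → Set
  Covers n ds lo hi = ∀ y → lo ≤ y → y < hi → Realises n ds y

  infixr 5 _⨾_
  _⨾_ : ∀ {n ds lo mid hi} → Covers n ds lo mid → Covers n ds mid hi → Covers n ds lo hi
  _⨾_ {mid = mid} below above y lo≤y y<hi with y <? mid
  ... | yes y<mid = below y lo≤y y<mid
  ... | no  y≮mid = above y (≮⇒≥ y≮mid) y<hi

  pos-∸ : ∀ {m n} → n ≤ m → + (m ∸ n) ≡ + m ℤ.- + n
  pos-∸ {m} {n} n≤m = trans (sym (ℤₚ.⊖-≥ n≤m)) (sym (ℤₚ.m-n≡m⊖n m n))

  run-x+c : ∀ {n ds d v a b c C lo hi} → (d , v) ∈ ds → b ≤ n → + c ≡ C → a + c ≡ lo → b + c ≡ hi →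
            (∀ {x} → a ≤ x → x < b → v x ≡ + x ℤ.+ C) → Covers n ds lo hi
  run-x+c {a = a} {b} {c} dv∈ds b≤n refl refl refl value y a+c≤y y<b+c =
    _ , _ , dv∈ds , y ∸ c , <-≤-trans x<b b≤n , inj₁ (trans (value a≤x x<b) (cong +_ x+c≡y))
    where
    x+c≡y : y ∸ c + c ≡ y
    x+c≡y = m∸n+n≡m (m+n≤o⇒n≤o a a+c≤y)
    a≤x : a ≤ y ∸ c
    a≤x = m+n≤o⇒m≤o∸n a a+c≤y
    x<b : y ∸ c < b
    x<b = +-cancelʳ-< c (y ∸ c) b (subst (_< b + c) (sym x+c≡y) y<b+c)

  run-x−c : ∀ {n ds d v a b c C lo hi} → (d , v) ∈ ds → b ≤ n → + c ≡ C → lo + c ≡ a → hi + c ≡ b →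
            (∀ {x} → a ≤ x → x < b → v x ≡ + x ℤ.- C) → Covers n ds lo hi
  run-x−c {c = c} dv∈ds b≤n refl refl refl value y lo≤y y<hi =
    _ , _ , dv∈ds , y + c , <-≤-trans x<b b≤n ,
    inj₁ (trans (value (+-monoˡ-≤ c lo≤y) x<b) (trans (sym (pos-∸ (m≤n+m c y))) (cong +_ (m+n∸n≡m y c))))
    where
    x<b = +-monoˡ-< c y<hi

  -- The rows lie below c, so the entries are the negatives −(c − x).
  run-c−x : ∀ {n ds d v a b c C lo hi} → (d , v) ∈ ds → b ≤ n → + c ≡ C → lo + b ≡ suc c → a + hi ≡ suc c →
            (∀ {x} → a ≤ x → x < b → v x ≡ + x ℤ.- C) → Covers n ds lo hi
  run-c−x {a = a} {b} {c} dv∈ds b≤n refl lo+b≡1+c a+hi≡1+c value y lo≤y y<hi =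
    _ , _ , dv∈ds , c ∸ y , <-≤-trans x<b b≤n ,
    inj₂ (trans (value a≤x x<b) (trans (cong (ℤ._- + c) (pos-∸ y≤c)) (cancel (+ c) (+ y))))
    where
    a+y<1+c : a + y < suc c
    a+y<1+c = subst (a + y <_) a+hi≡1+c (+-monoʳ-< a y<hi)
    y≤c : y ≤ c
    y≤c = ≤-pred (≤-trans (s≤s (m≤n+m y a)) a+y<1+c)
    a≤x : a ≤ c ∸ y
    a≤x = m+n≤o⇒m≤o∸n a (≤-pred a+y<1+c)
    c<b+y : c < b + y
    c<b+y = subst (c <_) (+-comm y b) (<-≤-trans (subst (c <_) (sym lo+b≡1+c) (n<1+n c)) (+-monoˡ-≤ b lo≤y))
    x<b : c ∸ y < b
    x<b = +-cancelʳ-< y (c ∸ y) b (subst (_< b + y) (sym (m∸n+n≡m y≤c)) c<b+y)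
    cancel : ∀ C Y → C ℤ.- Y ℤ.- C ≡ ℤ.- Y
    cancel = solve-∀

  run-c−4x : ∀ {n ds d v a len b c C y₀} → (d , v) ∈ ds → b ≤ n → + c ≡ C → a + len ≡ b → y₀ + 4 * b ≡ c + 4 →
             (∀ {x} → a ≤ x → x < b → v x ≡ C ℤ.- + 4 ℤ.* + x) → ∀ q → q < len → Realises n ds (y₀ + q * 4)
  run-c−4x {v = v} {a} {len} {c = c} {y₀ = y₀} dv∈ds b≤n refl refl y₀+4b≡c+4 value q q<len =
    _ , _ , dv∈ds , x , <-≤-trans x<b b≤n , inj₁ (begin
      v x                                      ≡⟨ value a≤x x<b ⟩
      + c ℤ.- + 4 ℤ.* + x                      ≡⟨ cong₂ ℤ._-_ (cong +_ c≡y+4x) (sym (ℤₚ.pos-* 4 x)) ⟩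
      + (y₀ + q * 4 + 4 * x) ℤ.- + (4 * x)     ≡⟨ sym (pos-∸ (m≤n+m (4 * x) (y₀ + q * 4))) ⟩
      + (y₀ + q * 4 + 4 * x ∸ 4 * x)           ≡⟨ cong +_ (m+n∸n≡m (y₀ + q * 4) (4 * x)) ⟩
      + (y₀ + q * 4)                           ∎)
    where
    open ≡.≡-Reasoning
    x = a + len ∸ suc q
    x+1+q≡b : x + suc q ≡ a + len
    x+1+q≡b = m∸n+n≡m (≤-trans q<len (m≤n+m len a))
    x<b : x < a + len
    x<b = subst (x <_) x+1+q≡b (m<m+n x (s≤s z≤n))
    a≤x : a ≤ x
    a≤x = m+n≤o⇒m≤o∸n a (+-monoʳ-≤ a q<len)
    rearrange : ∀ y q x → y + 4 * (x + suc q) ≡ y + q * 4 + 4 * x + 4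
    rearrange = ℕ-Solver.solve-∀
    c≡y+4x : c ≡ y₀ + q * 4 + 4 * x
    c≡y+4x = +-cancelʳ-≡ 4 c (y₀ + q * 4 + 4 * x)
               (trans (sym y₀+4b≡c+4) (trans (cong (λ b → y₀ + 4 * b) (sym x+1+q≡b)) (rearrange y₀ q x)))

open Circulant

⟦_≤_⟧ : ℕ → ℕ → ℤ
⟦ t ≤ x ⟧ = if t ≤ᵇ x then + 1 else + 0

⟦⟧-yes : ∀ {t x} → t ≤ x → ⟦ t ≤ x ⟧ ≡ + 1
⟦⟧-yes t≤x rewrite Equivalence.to T-≡ (ℕₚ.≤⇒≤ᵇ t≤x) = refl

⟦⟧-no : ∀ {t x} → x < t → ⟦ t ≤ x ⟧ ≡ + 0
⟦⟧-no {t} {x} x<t with t ≤ᵇ x in eq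
... | true  = ⊥-elim (ℕₚ.<⇒≱ x<t (ℕₚ.≤ᵇ⇒≤ t x (subst T (sym eq) _)))
... | false = refl

⟦⟧-cong : ∀ {t x s y} → t ≤ x ⇔ s ≤ y → ⟦ t ≤ x ⟧ ≡ ⟦ s ≤ y ⟧
⟦⟧-cong {t} {x} t≤x⇔s≤y with t ℕₚ.≤? x
... | yes t≤x = trans (⟦⟧-yes t≤x) (sym (⟦⟧-yes (Equivalence.to t≤x⇔s≤y t≤x)))
... | no  t≰x = trans (⟦⟧-no (ℕₚ.≰⇒> t≰x)) (sym (⟦⟧-no (ℕₚ.≰⇒> (t≰x ∘ Equivalence.from t≤x⇔s≤y))))

≤-witness : ∀ {a b} w → a ℕ.+ w ≡ b → a ≤ b
≤-witness {a} w refl = ℕₚ.m≤m+n a w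

pos-affine : ∀ a m b → + (a ℕ.* m ℕ.+ b) ≡ + a ℤ.* + m ℤ.+ + b
pos-affine a m b = trans (ℤₚ.pos-+ (a ℕ.* m) b) (cong (ℤ._+ + b) (ℤₚ.pos-* a m))

module Construction where
  open import Data.Integer using (_+_; _-_; _*_)

  -- n = 4m + 1, written as a polynomial in + m so that the ring solver can see through it.
  N : ℕ → ℤ
  N m = + 4 * + m + + 1

  diag₀ diagₘ diagₘ₊₁ diag₃ₘ diag₃ₘ₊₁ : ℕ → ℕ → ℤ
  diag₀    m x = + 5 * N m - + 4 * + x + N m * (⟦ m ℕ.+ 1 ≤ x ⟧ + ⟦ 2 ℕ.* m ℕ.+ 1 ≤ x ⟧ + ⟦ 3 ℕ.* m ℕ.+ 1 ≤ x ⟧)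
  diagₘ    m x = + x + + 3 * N m + N m * (⟦ m ℕ.+ 1 ≤ x ⟧ - ⟦ 1 ≤ x ⟧ - ⟦ 2 ℕ.* m ℕ.+ 1 ≤ x ⟧)
  diagₘ₊₁  m x = + x - N m - N m * ⟦ m ≤ x ⟧
  diag₃ₘ   m x = + x + + 3 * + m + + 1 + N m * (⟦ 1 ≤ x ⟧ - + 2 * ⟦ m ℕ.+ 1 ≤ x ⟧)
  diag₃ₘ₊₁ m x = + x + + 9 * + m + + 3 + N m * (⟦ m ≤ x ⟧ - ⟦ 3 ℕ.* m ℕ.+ 1 ≤ x ⟧)

  row-identity : ∀ M X a b c d e → let N = + 4 * M + + 1 in
    (+ 5 * N - + 4 * X + N * (a + b + c)) + ((X + + 3 * N + N * (a - d - b)) + ((X - N - N * e)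
      + ((X + + 3 * M + + 1 + N * (d - + 2 * a)) + ((X + + 9 * M + + 3 + N * (e - c)) + + 0))))
    ≡ + 40 * M + + 11
  row-identity = solve-∀

  -- The column sum once each row and bracket is written through j (see column-total), with
  -- e a b f c standing for ⟦ t ≤ j ⟧ at t = m, m + 1, 2m + 1, 3m, 3m + 1.
  column-identity : ∀ M J e a b f c → let N = + 4 * M + + 1 in
    (+ 5 * N - + 4 * J + N * (a + b + c))
    + ((J - M + N * (+ 1 - e) + + 3 * N + N * ((b + + 1 - e) - (a + + 1 - e) - (c + + 1 - e)))
    + ((J - (M + + 1) + N * (+ 1 - a) - N - N * (b + + 1 - a))
    + ((J - + 3 * M + N * (+ 1 - f) + + 3 * M + + 1 + N * ((c + + 1 - f) - + 2 * (+ 1 - f)))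
    + ((J - (+ 3 * M + + 1) + N * (+ 1 - c) + + 9 * M + + 3 + N * ((+ 1 - c) - (b - c)))
    + + 0))))
    ≡ + 40 * M + + 11
  column-identity = solve-∀

  private
    1≤m+1 : ∀ m → 1 ≤ m ℕ.+ 1
    1≤m+1 m = ℕₚ.m≤n+m 1 m
    m+1≤2m+1 : ∀ m → m ℕ.+ 1 ≤ 2 ℕ.* m ℕ.+ 1
    m+1≤2m+1 m = ≤-witness m (solve (m ∷ []))
    2m+1≤3m+1 : ∀ m → 2 ℕ.* m ℕ.+ 1 ≤ 3 ℕ.* m ℕ.+ 1
    2m+1≤3m+1 m = ≤-witness m (solve (m ∷ []))
    m≤3m+1 : ∀ m → m ≤ 3 ℕ.* m ℕ.+ 1
    m≤3m+1 m = ≤-witness (2 ℕ.* m ℕ.+ 1) (solve (m ∷ []))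
    1≤2m+1 : ∀ m → 1 ≤ 2 ℕ.* m ℕ.+ 1
    1≤2m+1 m = ℕₚ.≤-trans (1≤m+1 m) (m+1≤2m+1 m)
    m+1≤3m+1 : ∀ m → m ℕ.+ 1 ≤ 3 ℕ.* m ℕ.+ 1
    m+1≤3m+1 m = ℕₚ.≤-trans (m+1≤2m+1 m) (2m+1≤3m+1 m)

  diag₃ₘ-0 : ∀ {m x} → x < 1 → diag₃ₘ m x ≡ + x + (+ 3 * + m + + 1)
  diag₃ₘ-0 {m} {x} x<1 rewrite ⟦⟧-no x<1 | ⟦⟧-no (ℕₚ.<-≤-trans x<1 (1≤m+1 m)) = identity (+ m) (+ x)
    where
    identity : ∀ M X → X + + 3 * M + + 1 + (+ 4 * M + + 1) * (+ 0 - + 2 * + 0) ≡ X + (+ 3 * M + + 1)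
    identity = solve-∀

  diag₃ₘ-[1,m] : ∀ {m x} → 1 ≤ x → x < m ℕ.+ 1 → diag₃ₘ m x ≡ + x + (+ 7 * + m + + 2)
  diag₃ₘ-[1,m] {m} {x} 1≤x x<m+1 rewrite ⟦⟧-yes 1≤x | ⟦⟧-no x<m+1 = identity (+ m) (+ x)
    where
    identity : ∀ M X → X + + 3 * M + + 1 + (+ 4 * M + + 1) * (+ 1 - + 2 * + 0) ≡ X + (+ 7 * M + + 2)
    identity = solve-∀

  diag₃ₘ-[m+1,4m] : ∀ {m x} → m ℕ.+ 1 ≤ x → diag₃ₘ m x ≡ + x - + m
  diag₃ₘ-[m+1,4m] {m} {x} m+1≤x rewrite ⟦⟧-yes (ℕₚ.≤-trans (1≤m+1 m) m+1≤x) | ⟦⟧-yes m+1≤x = identity (+ m) (+ x)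
    where
    identity : ∀ M X → X + + 3 * M + + 1 + (+ 4 * M + + 1) * (+ 1 - + 2 * + 1) ≡ X - M
    identity = solve-∀

  diagₘ₊₁-[0,m-1] : ∀ {m x} → x < m → diagₘ₊₁ m x ≡ + x - (+ 4 * + m + + 1)
  diagₘ₊₁-[0,m-1] {m} {x} x<m rewrite ⟦⟧-no x<m = identity (+ m) (+ x)
    where
    identity : ∀ M X → X - (+ 4 * M + + 1) - (+ 4 * M + + 1) * + 0 ≡ X - (+ 4 * M + + 1)
    identity = solve-∀

  diagₘ₊₁-[m,4m] : ∀ {m x} → m ≤ x → diagₘ₊₁ m x ≡ + x - (+ 8 * + m + + 2)
  diagₘ₊₁-[m,4m] {m} {x} m≤x rewrite ⟦⟧-yes m≤x = identity (+ m) (+ x)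
    where
    identity : ∀ M X → X - (+ 4 * M + + 1) - (+ 4 * M + + 1) * + 1 ≡ X - (+ 8 * M + + 2)
    identity = solve-∀

  diagₘ-0 : ∀ {m x} → x < 1 → diagₘ m x ≡ + x + (+ 12 * + m + + 3)
  diagₘ-0 {m} {x} x<1
    rewrite ⟦⟧-no (ℕₚ.<-≤-trans x<1 (1≤m+1 m)) | ⟦⟧-no x<1 | ⟦⟧-no (ℕₚ.<-≤-trans x<1 (1≤2m+1 m))
    = identity (+ m) (+ x)
    where
    identity : ∀ M X → X + + 3 * (+ 4 * M + + 1) + (+ 4 * M + + 1) * (+ 0 - + 0 - + 0) ≡ X + (+ 12 * M + + 3)
    identity = solve-∀

  diagₘ-[1,m] : ∀ {m x} → 1 ≤ x → x < m ℕ.+ 1 → diagₘ m x ≡ + x + (+ 8 * + m + + 2)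
  diagₘ-[1,m] {m} {x} 1≤x x<m+1
    rewrite ⟦⟧-no x<m+1 | ⟦⟧-yes 1≤x | ⟦⟧-no (ℕₚ.<-≤-trans x<m+1 (m+1≤2m+1 m))
    = identity (+ m) (+ x)
    where
    identity : ∀ M X → X + + 3 * (+ 4 * M + + 1) + (+ 4 * M + + 1) * (+ 0 - + 1 - + 0) ≡ X + (+ 8 * M + + 2)
    identity = solve-∀

  diagₘ-[m+1,2m] : ∀ {m x} → m ℕ.+ 1 ≤ x → x < 2 ℕ.* m ℕ.+ 1 → diagₘ m x ≡ + x + (+ 12 * + m + + 3)
  diagₘ-[m+1,2m] {m} {x} m+1≤x x<2m+1
    rewrite ⟦⟧-yes m+1≤x | ⟦⟧-yes (ℕₚ.≤-trans (1≤m+1 m) m+1≤x) | ⟦⟧-no x<2m+1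
    = identity (+ m) (+ x)
    where
    identity : ∀ M X → X + + 3 * (+ 4 * M + + 1) + (+ 4 * M + + 1) * (+ 1 - + 1 - + 0) ≡ X + (+ 12 * M + + 3)
    identity = solve-∀

  diagₘ-[2m+1,4m] : ∀ {m x} → 2 ℕ.* m ℕ.+ 1 ≤ x → diagₘ m x ≡ + x + (+ 8 * + m + + 2)
  diagₘ-[2m+1,4m] {m} {x} 2m+1≤x
    rewrite ⟦⟧-yes (ℕₚ.≤-trans (m+1≤2m+1 m) 2m+1≤x) | ⟦⟧-yes (ℕₚ.≤-trans (1≤2m+1 m) 2m+1≤x) | ⟦⟧-yes 2m+1≤x
    = identity (+ m) (+ x)
    where
    identity : ∀ M X → X + + 3 * (+ 4 * M + + 1) + (+ 4 * M + + 1) * (+ 1 - + 1 - + 1) ≡ X + (+ 8 * M + + 2)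
    identity = solve-∀

  diag₃ₘ₊₁-[0,m-1] : ∀ {m x} → x < m → diag₃ₘ₊₁ m x ≡ + x + (+ 9 * + m + + 3)
  diag₃ₘ₊₁-[0,m-1] {m} {x} x<m rewrite ⟦⟧-no x<m | ⟦⟧-no (ℕₚ.<-≤-trans x<m (m≤3m+1 m)) = identity (+ m) (+ x)
    where
    identity : ∀ M X → X + + 9 * M + + 3 + (+ 4 * M + + 1) * (+ 0 - + 0) ≡ X + (+ 9 * M + + 3)
    identity = solve-∀

  diag₃ₘ₊₁-[m,3m] : ∀ {m x} → m ≤ x → x < 3 ℕ.* m ℕ.+ 1 → diag₃ₘ₊₁ m x ≡ + x + (+ 13 * + m + + 4)
  diag₃ₘ₊₁-[m,3m] {m} {x} m≤x x<3m+1 rewrite ⟦⟧-yes m≤x | ⟦⟧-no x<3m+1 = identity (+ m) (+ x)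
    where
    identity : ∀ M X → X + + 9 * M + + 3 + (+ 4 * M + + 1) * (+ 1 - + 0) ≡ X + (+ 13 * M + + 4)
    identity = solve-∀

  diag₃ₘ₊₁-[3m+1,4m] : ∀ {m x} → 3 ℕ.* m ℕ.+ 1 ≤ x → diag₃ₘ₊₁ m x ≡ + x + (+ 9 * + m + + 3)
  diag₃ₘ₊₁-[3m+1,4m] {m} {x} 3m+1≤x rewrite ⟦⟧-yes (ℕₚ.≤-trans (m≤3m+1 m) 3m+1≤x) | ⟦⟧-yes 3m+1≤x = identity (+ m) (+ x)
    where
    identity : ∀ M X → X + + 9 * M + + 3 + (+ 4 * M + + 1) * (+ 1 - + 1) ≡ X + (+ 9 * M + + 3)
    identity = solve-∀

  diag₀-[0,m] : ∀ {m x} → x < m ℕ.+ 1 → diag₀ m x ≡ + 20 * + m + + 5 - + 4 * + x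
  diag₀-[0,m] {m} {x} x<m+1
    rewrite ⟦⟧-no x<m+1 | ⟦⟧-no (ℕₚ.<-≤-trans x<m+1 (m+1≤2m+1 m)) | ⟦⟧-no (ℕₚ.<-≤-trans x<m+1 (m+1≤3m+1 m))
    = identity (+ m) (+ x)
    where
    identity : ∀ M X → + 5 * (+ 4 * M + + 1) - + 4 * X + (+ 4 * M + + 1) * (+ 0 + + 0 + + 0) ≡ + 20 * M + + 5 - + 4 * X
    identity = solve-∀

  diag₀-[m+1,2m] : ∀ {m x} → m ℕ.+ 1 ≤ x → x < 2 ℕ.* m ℕ.+ 1 → diag₀ m x ≡ + 24 * + m + + 6 - + 4 * + x
  diag₀-[m+1,2m] {m} {x} m+1≤x x<2m+1
    rewrite ⟦⟧-yes m+1≤x | ⟦⟧-no x<2m+1 | ⟦⟧-no (ℕₚ.<-≤-trans x<2m+1 (2m+1≤3m+1 m))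
    = identity (+ m) (+ x)
    where
    identity : ∀ M X → + 5 * (+ 4 * M + + 1) - + 4 * X + (+ 4 * M + + 1) * (+ 1 + + 0 + + 0) ≡ + 24 * M + + 6 - + 4 * X
    identity = solve-∀

  diag₀-[2m+1,3m] : ∀ {m x} → 2 ℕ.* m ℕ.+ 1 ≤ x → x < 3 ℕ.* m ℕ.+ 1 → diag₀ m x ≡ + 28 * + m + + 7 - + 4 * + x
  diag₀-[2m+1,3m] {m} {x} 2m+1≤x x<3m+1
    rewrite ⟦⟧-yes (ℕₚ.≤-trans (m+1≤2m+1 m) 2m+1≤x) | ⟦⟧-yes 2m+1≤x | ⟦⟧-no x<3m+1
    = identity (+ m) (+ x)
    where
    identity : ∀ M X → + 5 * (+ 4 * M + + 1) - + 4 * X + (+ 4 * M + + 1) * (+ 1 + + 1 + + 0) ≡ + 28 * M + + 7 - + 4 * X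
    identity = solve-∀

  diag₀-[3m+1,4m] : ∀ {m x} → 3 ℕ.* m ℕ.+ 1 ≤ x → diag₀ m x ≡ + 32 * + m + + 8 - + 4 * + x
  diag₀-[3m+1,4m] {m} {x} 3m+1≤x
    rewrite ⟦⟧-yes (ℕₚ.≤-trans (m+1≤3m+1 m) 3m+1≤x) | ⟦⟧-yes (ℕₚ.≤-trans (2m+1≤3m+1 m) 3m+1≤x) | ⟦⟧-yes 3m+1≤x
    = identity (+ m) (+ x)
    where
    identity : ∀ M X → + 5 * (+ 4 * M + + 1) - + 4 * X + (+ 4 * M + + 1) * (+ 1 + + 1 + + 1) ≡ + 32 * M + + 8 - + 4 * X
    identity = solve-∀

open Construction
open import Data.Nat using (_+_; _*_; _∸_)

⟦⟧-∸ : ∀ t {d o} → d ≤ o → ⟦ t ≤ o ∸ d ⟧ ≡ ⟦ t + d ≤ o ⟧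
⟦⟧-∸ t d≤o = ⟦⟧-cong (mk⇔ (ℕₚ.m≤o∸n⇒m+n≤o t d≤o) (ℕₚ.m+n≤o⇒m≤o∸n t))

subMod-ℤ : ∀ {n j d D N} → + d ≡ D → + n ≡ N → d ≤ n → + subMod n j d ≡ + j ℤ.- D ℤ.+ N ℤ.* (+ 1 ℤ.- ⟦ d ≤ j ⟧)
subMod-ℤ {n} {j} {d} refl refl d≤n with d ≤ᵇ j in eq
... | true  = trans (pos-∸ (ℕₚ.≤ᵇ⇒≤ d j (subst T (sym eq) _))) (case-d≤j (+ j) (+ d) (+ n))
  where
  case-d≤j : ∀ J D N → J ℤ.- D ≡ J ℤ.- D ℤ.+ N ℤ.* (+ 1 ℤ.- + 1)
  case-d≤j = solve-∀
... | false = trans (pos-∸ (ℕₚ.≤-trans d≤n (ℕₚ.m≤m+n n j)))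
                (trans (cong (ℤ._- + d) (ℤₚ.pos-+ n j)) (case-j<d (+ j) (+ d) (+ n)))
  where
  case-j<d : ∀ J D N → N ℤ.+ J ℤ.- D ≡ J ℤ.- D ℤ.+ N ℤ.* (+ 1 ℤ.- + 0)
  case-j<d = solve-∀

⟦⟧-subMod-direct : ∀ {n j d t s} → t + d ≡ s → s ≤ n → ⟦ t ≤ subMod n j d ⟧ ≡ ⟦ s ≤ j ⟧ ℤ.+ + 1 ℤ.- ⟦ d ≤ j ⟧
⟦⟧-subMod-direct {n} {j} {d} {t} {s} t+d≡s s≤n with d ≤ᵇ j in eq
... | true  = trans (⟦⟧-∸ t (ℕₚ.≤ᵇ⇒≤ d j (subst T (sym eq) _)))
                (trans (cong (λ s → ⟦ s ≤ j ⟧) t+d≡s) (sym (cancel ⟦ s ≤ j ⟧)))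
  where
  cancel : ∀ b → b ℤ.+ + 1 ℤ.- + 1 ≡ b
  cancel = solve-∀
... | false = trans (⟦⟧-∸ t (ℕₚ.≤-trans (ℕₚ.m+n≤o⇒n≤o t t+d≤n) (ℕₚ.m≤m+n n j)))
              (trans (⟦⟧-yes (ℕₚ.≤-trans t+d≤n (ℕₚ.m≤m+n n j))) (cong (λ b → b ℤ.+ + 1 ℤ.- + 0) (sym (⟦⟧-no j<s))))
  where
  t+d≤n : t + d ≤ n
  t+d≤n = subst (_≤ n) (sym t+d≡s) s≤n
  j<s : j < s
  j<s = ℕₚ.<-≤-trans (ℕₚ.≰⇒> (λ d≤j → subst T eq (ℕₚ.≤⇒≤ᵇ d≤j))) (subst (d ≤_) t+d≡s (ℕₚ.m≤n+m d t))

⟦⟧-subMod-wrapped : ∀ {n j d t s} → j < n → d ≤ n → t ≤ n → t + d ≡ s + n →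
                    ⟦ t ≤ subMod n j d ⟧ ≡ ⟦ s ≤ j ⟧ ℤ.- ⟦ d ≤ j ⟧
⟦⟧-subMod-wrapped {n} {j} {d} {t} {s} j<n d≤n t≤n t+d≡s+n with d ≤ᵇ j in eq
... | true  = trans (⟦⟧-∸ t d≤j) (trans (⟦⟧-no j<t+d) (cong (ℤ._- + 1) (sym (⟦⟧-yes s≤j))))
  where
  d≤j = ℕₚ.≤ᵇ⇒≤ d j (subst T (sym eq) _)
  j<t+d : j < t + d
  j<t+d = ℕₚ.<-≤-trans j<n (subst (n ≤_) (sym t+d≡s+n) (ℕₚ.m≤n+m n s))
  s≤j : s ≤ j
  s≤j = ℕₚ.≤-trans (ℕₚ.+-cancelʳ-≤ n s d (subst₂ _≤_ t+d≡s+n (ℕₚ.+-comm n d) (ℕₚ.+-monoˡ-≤ d t≤n))) d≤j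
... | false = trans (⟦⟧-∸ t (ℕₚ.≤-trans d≤n (ℕₚ.m≤m+n n j)))
                (trans (⟦⟧-cong (mk⇔ (λ le → ℕₚ.+-cancelˡ-≤ n s j (subst (_≤ n + j) t+d≡n+s le))
                                     (λ le → subst (_≤ n + j) (sym t+d≡n+s) (ℕₚ.+-monoʳ-≤ n le))))
                       (sym (ℤₚ.+-identityʳ ⟦ s ≤ j ⟧)))
  where
  t+d≡n+s : t + d ≡ n + s
  t+d≡n+s = trans t+d≡s+n (ℕₚ.+-comm s n)

module Bounds (m : ℕ) where
  1≤n : 1 ≤ 4 * m + 1
  1≤n = ≤-witness (4 * m) (solve (m ∷ []))
  m≤n : m ≤ 4 * m + 1
  m≤n = ≤-witness (3 * m + 1) (solve (m ∷ []))
  m+1≤n : m + 1 ≤ 4 * m + 1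
  m+1≤n = ≤-witness (3 * m) (solve (m ∷ []))
  2m+1≤n : 2 * m + 1 ≤ 4 * m + 1
  2m+1≤n = ≤-witness (2 * m) (solve (m ∷ []))
  3m≤n : 3 * m ≤ 4 * m + 1
  3m≤n = ≤-witness (m + 1) (solve (m ∷ []))
  3m+1≤n : 3 * m + 1 ≤ 4 * m + 1
  3m+1≤n = ≤-witness m (solve (m ∷ []))

heffterDiagonals : ℕ → List Diagonal
heffterDiagonals m =
  (0 , diag₀ m) ∷ (m , diagₘ m) ∷ (m + 1 , diagₘ₊₁ m) ∷ (3 * m , diag₃ₘ m) ∷ (3 * m + 1 , diag₃ₘ₊₁ m) ∷ []

row-total : ∀ m x → ℤ-lines.∑ₗ (heffterDiagonals m) (λ (d , v) → v x) ≡ + 40 ℤ.* + m ℤ.+ + 11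
row-total m x = row-identity (+ m) (+ x) ⟦ m + 1 ≤ x ⟧ ⟦ 2 * m + 1 ≤ x ⟧ ⟦ 3 * m + 1 ≤ x ⟧ ⟦ 1 ≤ x ⟧ ⟦ m ≤ x ⟧

-- Diagonal d meets column j in row subMod n j d; rewrite that row, and each bracket of it, in terms of j.
column-total : ∀ m j → j < 4 * m + 1 →
  ℤ-lines.∑ₗ (heffterDiagonals m) (λ (d , v) → v (subMod (4 * m + 1) j d)) ≡ + 40 ℤ.* + m ℤ.+ + 11
column-total m j j<n
  rewrite subMod-ℤ {j = j} {d = m}         refl                                              (pos-affine 4 m 1) (Bounds.m≤n m)
        | subMod-ℤ {j = j} {d = m + 1}     (ℤₚ.pos-+ m 1)                                    (pos-affine 4 m 1) (Bounds.m+1≤n m)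
        | subMod-ℤ {j = j} {d = 3 * m}     (ℤₚ.pos-* 3 m)                                    (pos-affine 4 m 1) (Bounds.3m≤n m)
        | subMod-ℤ {j = j} {d = 3 * m + 1} (pos-affine 3 m 1)                                (pos-affine 4 m 1) (Bounds.3m+1≤n m)
        | ⟦⟧-subMod-direct {n = 4 * m + 1} {j} {m}     {t = m + 1}     {s = 2 * m + 1} (solve (m ∷ [])) (Bounds.2m+1≤n m)
        | ⟦⟧-subMod-direct {n = 4 * m + 1} {j} {m}     {t = 1}         {s = m + 1}     (solve (m ∷ [])) (Bounds.m+1≤n m)
        | ⟦⟧-subMod-direct {n = 4 * m + 1} {j} {m}     {t = 2 * m + 1} {s = 3 * m + 1} (solve (m ∷ [])) (Bounds.3m+1≤n m)
        | ⟦⟧-subMod-direct {n = 4 * m + 1} {j} {m + 1} {t = m}         {s = 2 * m + 1} (solve (m ∷ [])) (Bounds.2m+1≤n m)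
        | ⟦⟧-subMod-direct {n = 4 * m + 1} {j} {3 * m} {t = 1}         {s = 3 * m + 1} (solve (m ∷ [])) (Bounds.3m+1≤n m)
        | ⟦⟧-subMod-wrapped {n = 4 * m + 1} {j} {3 * m}     {t = m + 1}     {s = 0}         j<n (Bounds.3m≤n m)   (Bounds.m+1≤n m)  (solve (m ∷ []))
        | ⟦⟧-subMod-wrapped {n = 4 * m + 1} {j} {3 * m + 1} {t = m}         {s = 0}         j<n (Bounds.3m+1≤n m) (Bounds.m≤n m)    (solve (m ∷ []))
        | ⟦⟧-subMod-wrapped {n = 4 * m + 1} {j} {3 * m + 1} {t = 3 * m + 1} {s = 2 * m + 1} j<n (Bounds.3m+1≤n m) (Bounds.3m+1≤n m) (solve (m ∷ []))
  = column-identity (+ m) (+ j) ⟦ m ≤ j ⟧ ⟦ m + 1 ≤ j ⟧ ⟦ 2 * m + 1 ≤ j ⟧ ⟦ 3 * m ≤ j ⟧ ⟦ 3 * m + 1 ≤ j ⟧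

HeffterCovers : ℕ → ℕ → ℕ → Set
HeffterCovers m = Covers (4 * m + 1) (heffterDiagonals m)

module _ {m : ℕ} where
  ∈-diag₀ : (0 , diag₀ m) ∈ heffterDiagonals m
  ∈-diag₀ = here refl
  ∈-diagₘ : (m , diagₘ m) ∈ heffterDiagonals m
  ∈-diagₘ = there (here refl)
  ∈-diagₘ₊₁ : (m + 1 , diagₘ₊₁ m) ∈ heffterDiagonals m
  ∈-diagₘ₊₁ = there (there (here refl))
  ∈-diag₃ₘ : (3 * m , diag₃ₘ m) ∈ heffterDiagonals m
  ∈-diag₃ₘ = there (there (there (here refl)))
  ∈-diag₃ₘ₊₁ : (3 * m + 1 , diag₃ₘ₊₁ m) ∈ heffterDiagonals m
  ∈-diag₃ₘ₊₁ = there (there (there (there (here refl))))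

covers-below-16m+5 : ∀ m → HeffterCovers m 1 (16 * m + 5)
covers-below-16m+5 m =
  values-[1,3m] ⨾ value-3m+1 ⨾ values-[3m+2,4m+1] ⨾ values-[4m+2,7m+2] ⨾ values-[7m+3,8m+2] ⨾ values-[8m+3,9m+2] ⨾
  values-[9m+3,10m+2] ⨾ values-[10m+3,12m+2] ⨾ value-12m+3 ⨾ values-[12m+4,13m+3] ⨾ values-[13m+4,14m+3] ⨾ values-[14m+4,16m+4]
  where
  open Bounds m
  values-[1,3m] : HeffterCovers m 1 (3 * m + 1)
  values-[1,3m] =
    run-x−c {a = m + 1} {b = 4 * m + 1} {c = m} {lo = 1} {hi = 3 * m + 1}
      ∈-diag₃ₘ ℕₚ.≤-refl refl (ℕₚ.+-comm 1 m) (solve (m ∷ []))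
      λ m+1≤x _ → diag₃ₘ-[m+1,4m] {m} m+1≤x
  value-3m+1 : HeffterCovers m (3 * m + 1) (3 * m + 2)
  value-3m+1 =
    run-x+c {a = 0} {b = 1} {c = 3 * m + 1} {lo = 3 * m + 1} {hi = 3 * m + 2}
      ∈-diag₃ₘ 1≤n (pos-affine 3 m 1) refl (solve (m ∷ []))
      λ _ x<1 → diag₃ₘ-0 {m} x<1
  values-[3m+2,4m+1] : HeffterCovers m (3 * m + 2) (4 * m + 2)
  values-[3m+2,4m+1] =
    run-c−x {a = 0} {b = m} {c = 4 * m + 1} {lo = 3 * m + 2} {hi = 4 * m + 2}
      ∈-diagₘ₊₁ m≤n (pos-affine 4 m 1) (solve (m ∷ [])) (solve (m ∷ []))
      λ _ x<m → diagₘ₊₁-[0,m-1] {m} x<m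
  values-[4m+2,7m+2] : HeffterCovers m (4 * m + 2) (7 * m + 3)
  values-[4m+2,7m+2] =
    run-c−x {a = m} {b = 4 * m + 1} {c = 8 * m + 2} {lo = 4 * m + 2} {hi = 7 * m + 3}
      ∈-diagₘ₊₁ ℕₚ.≤-refl (pos-affine 8 m 2) (solve (m ∷ [])) (solve (m ∷ []))
      λ m≤x _ → diagₘ₊₁-[m,4m] {m} m≤x
  values-[7m+3,8m+2] : HeffterCovers m (7 * m + 3) (8 * m + 3)
  values-[7m+3,8m+2] =
    run-x+c {a = 1} {b = m + 1} {c = 7 * m + 2} {lo = 7 * m + 3} {hi = 8 * m + 3}
      ∈-diag₃ₘ m+1≤n (pos-affine 7 m 2) (solve (m ∷ [])) (solve (m ∷ []))
      (diag₃ₘ-[1,m] {m})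
  values-[8m+3,9m+2] : HeffterCovers m (8 * m + 3) (9 * m + 3)
  values-[8m+3,9m+2] =
    run-x+c {a = 1} {b = m + 1} {c = 8 * m + 2} {lo = 8 * m + 3} {hi = 9 * m + 3}
      ∈-diagₘ m+1≤n (pos-affine 8 m 2) (solve (m ∷ [])) (solve (m ∷ []))
      (diagₘ-[1,m] {m})
  values-[9m+3,10m+2] : HeffterCovers m (9 * m + 3) (10 * m + 3)
  values-[9m+3,10m+2] =
    run-x+c {a = 0} {b = m} {c = 9 * m + 3} {lo = 9 * m + 3} {hi = 10 * m + 3}
      ∈-diag₃ₘ₊₁ m≤n (pos-affine 9 m 3) refl (solve (m ∷ []))
      λ _ x<m → diag₃ₘ₊₁-[0,m-1] {m} x<m
  values-[10m+3,12m+2] : HeffterCovers m (10 * m + 3) (12 * m + 3)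
  values-[10m+3,12m+2] =
    run-x+c {a = 2 * m + 1} {b = 4 * m + 1} {c = 8 * m + 2} {lo = 10 * m + 3} {hi = 12 * m + 3}
      ∈-diagₘ ℕₚ.≤-refl (pos-affine 8 m 2) (solve (m ∷ [])) (solve (m ∷ []))
      λ 2m+1≤x _ → diagₘ-[2m+1,4m] {m} 2m+1≤x
  value-12m+3 : HeffterCovers m (12 * m + 3) (12 * m + 4)
  value-12m+3 =
    run-x+c {a = 0} {b = 1} {c = 12 * m + 3} {lo = 12 * m + 3} {hi = 12 * m + 4}
      ∈-diagₘ 1≤n (pos-affine 12 m 3) refl (solve (m ∷ []))
      λ _ x<1 → diagₘ-0 {m} x<1
  values-[12m+4,13m+3] : HeffterCovers m (12 * m + 4) (13 * m + 4)
  values-[12m+4,13m+3] =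
    run-x+c {a = 3 * m + 1} {b = 4 * m + 1} {c = 9 * m + 3} {lo = 12 * m + 4} {hi = 13 * m + 4}
      ∈-diag₃ₘ₊₁ ℕₚ.≤-refl (pos-affine 9 m 3) (solve (m ∷ [])) (solve (m ∷ []))
      λ 3m+1≤x _ → diag₃ₘ₊₁-[3m+1,4m] {m} 3m+1≤x
  values-[13m+4,14m+3] : HeffterCovers m (13 * m + 4) (14 * m + 4)
  values-[13m+4,14m+3] =
    run-x+c {a = m + 1} {b = 2 * m + 1} {c = 12 * m + 3} {lo = 13 * m + 4} {hi = 14 * m + 4}
      ∈-diagₘ 2m+1≤n (pos-affine 12 m 3) (solve (m ∷ [])) (solve (m ∷ []))
      (diagₘ-[m+1,2m] {m})
  values-[14m+4,16m+4] : HeffterCovers m (14 * m + 4) (16 * m + 5)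
  values-[14m+4,16m+4] =
    run-x+c {a = m} {b = 3 * m + 1} {c = 13 * m + 4} {lo = 14 * m + 4} {hi = 16 * m + 5}
      ∈-diag₃ₘ₊₁ 3m+1≤n (pos-affine 13 m 4) (solve (m ∷ [])) (solve (m ∷ []))
      (diag₃ₘ₊₁-[m,3m] {m})

-- The main diagonal drops by 4 from row to row; its four blocks of rows realise the four residue
-- classes mod 4 of the values from 16m + 5 to 20m + 5.
values-[16m+5,20m+5] : ∀ m → HeffterCovers m (16 * m + 5) (20 * m + 6)
values-[16m+5,20m+5] m y 16m+5≤y y<20m+6 = subst R (ℕₚ.m+[n∸m]≡n 16m+5≤y) (by-residue (y ∸ (16 * m + 5)) t≤4m)
  where
  open Bounds m
  R : ℕ → Set
  R = Realises (4 * m + 1) (heffterDiagonals m)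
  t≤4m : y ∸ (16 * m + 5) ≤ 4 * m
  t≤4m = ℕₚ.≤-pred (ℕₚ.+-cancelˡ-< (16 * m + 5) (y ∸ (16 * m + 5)) (suc (4 * m))
           (subst₂ _<_ (sym (ℕₚ.m+[n∸m]≡n 16m+5≤y)) split y<20m+6))
    where
    split : 20 * m + 6 ≡ 16 * m + 5 + suc (4 * m)
    split = solve (m ∷ [])
  block₀ : ∀ q → q < m + 1 → R (16 * m + 5 + q * 4)
  block₀ = run-c−4x {a = 0} {len = m + 1} {b = m + 1} {c = 20 * m + 5} {y₀ = 16 * m + 5}
    ∈-diag₀ m+1≤n (pos-affine 20 m 5) refl (solve (m ∷ [])) λ _ x<m+1 → diag₀-[0,m] {m} x<m+1
  block₁ : ∀ q → q < m → R (16 * m + 5 + 1 + q * 4)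
  block₁ = run-c−4x {a = m + 1} {len = m} {b = 2 * m + 1} {c = 24 * m + 6} {y₀ = 16 * m + 5 + 1}
    ∈-diag₀ 2m+1≤n (pos-affine 24 m 6) (solve (m ∷ [])) (solve (m ∷ [])) (diag₀-[m+1,2m] {m})
  block₂ : ∀ q → q < m → R (16 * m + 5 + 2 + q * 4)
  block₂ = run-c−4x {a = 2 * m + 1} {len = m} {b = 3 * m + 1} {c = 28 * m + 7} {y₀ = 16 * m + 5 + 2}
    ∈-diag₀ 3m+1≤n (pos-affine 28 m 7) (solve (m ∷ [])) (solve (m ∷ [])) (diag₀-[2m+1,3m] {m})
  block₃ : ∀ q → q < m → R (16 * m + 5 + 3 + q * 4)
  block₃ = run-c−4x {a = 3 * m + 1} {len = m} {b = 4 * m + 1} {c = 32 * m + 8} {y₀ = 16 * m + 5 + 3}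
    ∈-diag₀ ℕₚ.≤-refl (pos-affine 32 m 8) (solve (m ∷ [])) (solve (m ∷ [])) λ 3m+1≤x _ → diag₀-[3m+1,4m] {m} 3m+1≤x
  quotient< : ∀ {ρ q} → suc ρ + q * 4 ≤ 4 * m → q < m
  quotient< {ρ} {q} bound =
    ℕₚ.*-cancelʳ-< 4 q m (subst (q * 4 <_) (ℕₚ.*-comm 4 m) (ℕₚ.<-≤-trans (s≤s (ℕₚ.m≤n+m (q * 4) ρ)) bound))
  residue : ∀ ρ q → ρ < 4 → ρ + q * 4 ≤ 4 * m → R (16 * m + 5 + (ρ + q * 4))
  residue 0 q _ bound = block₀ q (subst (q <_) (ℕₚ.+-comm 1 m) (s≤s (ℕₚ.*-cancelʳ-≤ q m 4 (subst (q * 4 ≤_) (ℕₚ.*-comm 4 m) bound))))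
  residue 1 q _ bound = subst R (ℕₚ.+-assoc (16 * m + 5) 1 (q * 4)) (block₁ q (quotient< bound))
  residue 2 q _ bound = subst R (ℕₚ.+-assoc (16 * m + 5) 2 (q * 4)) (block₂ q (quotient< bound))
  residue 3 q _ bound = subst R (ℕₚ.+-assoc (16 * m + 5) 3 (q * 4)) (block₃ q (quotient< bound))
  residue (suc (suc (suc (suc _)))) _ (s≤s (s≤s (s≤s (s≤s ())))) _
  by-residue : ∀ t → t ≤ 4 * m → R (16 * m + 5 + t)
  by-residue t t≤4m = subst (λ t → R (16 * m + 5 + t)) (sym t≡ρ+4q)
                        (residue (t % 4) (t / 4) (DM.m%n<n t 4) (subst (_≤ 4 * m) t≡ρ+4q t≤4m))
    where
    t≡ρ+4q : t ≡ t % 4 + t / 4 * 4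
    t≡ρ+4q = DM.m≡m%n+[m/n]*n t 4

module _ (m : ℕ) (1≤m : 1 ≤ m) where
  private
    m<m+1 : m < m + 1
    m<m+1 = ℕₚ.m<m+n m (s≤s z≤n)
    m+1<3m : m + 1 < 3 * m
    m+1<3m = subst₂ _≤_ 2+m≡ 3m≡ (ℕₚ.+-monoʳ-≤ m (ℕₚ.+-mono-≤ 1≤m 1≤m))
      where
      2+m≡ : m + (1 + 1) ≡ suc (m + 1)
      2+m≡ = solve (m ∷ [])
      3m≡ : m + (m + m) ≡ 3 * m
      3m≡ = solve (m ∷ [])
    3m<3m+1 : 3 * m < 3 * m + 1
    3m<3m+1 = ℕₚ.m<m+n (3 * m) (s≤s z≤n)
    3m+1<n : 3 * m + 1 < 4 * m + 1
    3m+1<n = ℕₚ.+-monoˡ-< 1 (subst₂ _≤_ (ℕₚ.+-comm (3 * m) 1) 4m≡ (ℕₚ.+-monoʳ-≤ (3 * m) 1≤m))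
      where
      4m≡ : 3 * m + m ≡ 4 * m
      4m≡ = solve (m ∷ [])

  heffter-offsets-unique : Unique (offsets (heffterDiagonals m))
  heffter-offsets-unique =
    AllPairs.map ℕₚ.<⇒≢ (Linked⇒AllPairs ℕₚ.<-trans (1≤m Linked.∷ m<m+1 Linked.∷ m+1<3m Linked.∷ 3m<3m+1 Linked.∷ Linked.[-]))

  heffter-offsets-bounded : All (_< 4 * m + 1) (offsets (heffterDiagonals m))
  heffter-offsets-bounded =
    Bounds.1≤n m All.∷ <n (ℕₚ.<-trans m<m+1 m+1<3m+1) All.∷ <n m+1<3m+1 All.∷ <n 3m<3m+1 All.∷ 3m+1<n All.∷ All.[]
    where
    m+1<3m+1 : m + 1 < 3 * m + 1
    m+1<3m+1 = ℕₚ.<-trans m+1<3m 3m<3m+1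
    <n : ∀ {x} → x < 3 * m + 1 → x < 4 * m + 1
    <n x<3m+1 = ℕₚ.<-trans x<3m+1 3m+1<n

divisible-by-order : ∀ m {s} → s ≡ + 40 ℤ.* + m ℤ.+ + 11 → + (2 * (4 * m + 1) * 5 + 1) ∣ s
divisible-by-order m {s} s≡40m+11 =
  subst (+ (2 * (4 * m + 1) * 5 + 1) ∣_) (trans (trans (cong +_ order) (pos-affine 40 m 11)) (sym s≡40m+11)) ∣-refl
  where
  order : 2 * (4 * m + 1) * 5 + 1 ≡ 40 * m + 11
  order = solve (m ∷ [])

heffter-4m+1 : ∀ m → 1 ≤ m → HeffterArray (4 * m + 1) 5
heffter-4m+1 m 1≤m = circulant (4 * m + 1) (heffterDiagonals m) ,
  circulant-isHeffter (4 * m + 1) (heffterDiagonals m) (heffter-offsets-unique m 1≤m) (heffter-offsets-bounded m 1≤m)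
    (λ x _   → divisible-by-order m (row-total m x))
    (λ j j<n → divisible-by-order m (column-total m j j<n))
    (λ y 1≤y y≤5n → (covers-below-16m+5 m ⨾ values-[16m+5,20m+5] m) y 1≤y (subst (y <_) 5n+1≡20m+6 (s≤s y≤5n)))
  where
  5n+1≡20m+6 : suc ((4 * m + 1) * 5) ≡ 20 * m + 6
  5n+1≡20m+6 = solve (m ∷ [])

lemma6p1 : ∀ (n : ℕ) → 13 ≤ n → n % 4 ≡ 1 → HeffterArray n 5
lemma6p1 n 13≤n n%4≡1 = subst (λ k → HeffterArray k 5) (sym n≡4m+1) (heffter-4m+1 (n / 4) 1≤n/4)
  where
  n≡4m+1 : n ≡ 4 * (n / 4) + 1
  n≡4m+1 = trans (DM.m≡m%n+[m/n]*n n 4) (trans (cong (_+ n / 4 * 4) n%4≡1) (trans (ℕₚ.+-comm 1 _) (cong (_+ 1) (ℕₚ.*-comm (n / 4) 4))))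
  1≤n/4 : 1 ≤ n / 4
  1≤n/4 = ℕₚ.≤-trans (s≤s z≤n) (DM./-monoˡ-≤ 4 13≤n)
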